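{- Let $\mathcal{A}$ be an MPFS algorithm for $\mathrm{OFA}(S,1)$ with $|S|=k$, let $\sigma=r_1\cdots r_k$ be a request sequence, $1\le i\le k$, and $s\in F_{i-1}(\mathcal{A})$ with $s\ne s_{\mathcal{A}}(r_i;\sigma)$. Let $t^*\ge i$ be such that $F_t(\mathcal{A})\ne F_t(\mathcal{H}_{i,s})$ for $i\le t\le t^*$ and $F_t(\mathcal{A})=F_t(\mathcal{H}_{i,s})$ for $t\ge t^*+1$, and for $i\le t\le t^*$ let $a_t,h_t$ be the servers with $F_t(\mathcal{A})\setminus F_t(\mathcal{H}_{i,s})=\{a_t\}$ and $F_t(\mathcal{H}_{i,s})\setminus F_t(\mathcal{A})=\{h_t\}$. Then: (P1) $a_t=a_{t+1}$ or $h_t=h_{t+1}$ for each $i\le t\le t^*-1$; (P2) for each $i\le t\le t^*-1$: if $a_t\neq a_{t+1}$, then $r_{t+1}$ is matched with $a_t$ by $\mathcal{A}$ and with $a_{t+1}$ by $\mathcal{H}_{i,s}$; if $h_t\ne h_{t+1}$, then $r_{t+1}$ is matched with $h_{t+1}$ by $\mathcal{A}$ and with $h_t$ by $\mathcal{H}_{i,s}$; (P3) $r_{t^*+1}$ is matched with $a_{t^*}$ by $\mathcal{A}$ and with $h_{t^*}$ by $\mathcal{H}_{i,s}$.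
   Context: Online facility assignment $\mathrm{OFA}(S,1)$ on a metric space $(X,d)$: $S$ is a set of $k$ servers at points of $X$, each of capacity 1; requests arrive one at a time and each must be irrevocably matched upon arrival with a free (not yet matched) server, at cost equal to the distance. $s_{\mathcal{A}}(r_i;\sigma)$ is the server with which $\mathcal{A}$ matches $r_i$ on $\sigma$; $F_i(\mathcal{A})$ is the set of free servers just after $\mathcal{A}$ matches $r_i$ ($F_0=S$). MPFS algorithm: for each request a priority order on all servers is determined solely by the request's position, and the request is matched with the free server of highest priority. Hybrid algorithm $\mathcal{H}_{i,s}$ (for $s\in F_{i-1}(\mathcal{A})$): matches $r_1,\ldots,r_{i-1}$ as $\mathcal{A}$ does, $r_i$ with $s$, and each later request with its highest-priority server (under $\mathcal{A}$'s priority rule) among its own current free servers. (The index $t^*$ and servers $a_t,h_t$ as in the claim exist under these hypotheses.) -}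

module Defs where

open import Data.Nat using (ℕ; zero; suc)
open import Data.Fin using (Fin)
open import Data.Fin.Subset using (Subset; ⊤; _-_)
open import Data.Fin.Subset.Properties using (_∈?_)
open import Data.Fin.Permutation using (Permutation′; _⟨$⟩ʳ_)
open import Data.List using (List; []; _∷_; map; filter; allFin)
open import Data.Maybe using (Maybe; just; nothing)
open import Data.Vec using (Vec; []; _∷_)
open import Data.Bool using (if_then_else_)
open import Relation.Nullary.Decidable using (⌊_⌋)
open import Data.Nat using (_≟_)

-- A priority order on the k servers (Fin k): π ⟨$⟩ʳ j is the server of the
-- j-th highest priority (j = 0 is the highest priority).
-- An MPFS algorithm on requests located at points of X is given by a
-- priority rule  X → Permutation′ k  (priority depends only on the position).
PriorityRule : ℕ → Set → Set
PriorityRule k X = X → Permutation′ k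

pick : {k : ℕ} → Permutation′ k → Subset k → Maybe (Fin k)
pick {k} π F with filter (λ s → s ∈? F) (map (π ⟨$⟩ʳ_) (allFin k))
... | []    = nothing
... | s ∷ _ = just s

remove : {k : ℕ} → Maybe (Fin k) → Subset k → Subset k
remove (just s) F = F - s
remove nothing  F = F

-- the request at (1-based) time t+1, i.e. r_{t+1}, if it exists
nth : {X : Set} {n : ℕ} → Vec X n → ℕ → Maybe X
nth []       _       = nothing
nth (x ∷ xs) zero    = just x
nth (x ∷ xs) (suc j) = nth xs j

-- A policy: given the (1-based) time t, the request r_t and the current
-- free-server set, choose the server to match r_t with.
Policy : ℕ → Set → Set
Policy k X = ℕ → X → Subset k → Maybe (Fin k)

free : {k n : ℕ} {X : Set} → Policy k X → Vec X n → ℕ → Subset k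
matched : {k n : ℕ} {X : Set} → Policy k X → Vec X n → ℕ → Maybe (Fin k)

free c σ zero    = ⊤
free c σ (suc j) = remove (matched c σ (suc j)) (free c σ j)

matched c σ zero    = nothing
matched c σ (suc j) with nth σ j
... | nothing = nothing
... | just x  = c (suc j) x (free c σ j)

MPFS : {k : ℕ} {X : Set} → PriorityRule k X → Policy k X
MPFS pri t x F = pick (pri x) F

-- The hybrid algorithm ℋ_{i,s}: like 𝒜 on r_1 … r_{i-1}, r_i ↦ s,
-- later requests get their highest-priority server among ℋ's own free servers.
Hybrid : {k : ℕ} {X : Set} → PriorityRule k X → ℕ → Fin k → Policy k X
Hybrid pri i s t x F = if ⌊ t ≟ i ⌋ then just s else pick (pri x) F

-- While the free sets of 𝒜 and ℋ differ by exchanging a_t for h_t, both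
-- algorithms scan the same priority list for r_{t+1}.  The first server that
-- is free for either of them is a server free for both (then nothing changes),
-- or a_t, or h_t; in the last two cases the other algorithm continues down the
-- list to a common server or to its own exclusive one.  This case analysis
-- gives (P1) and (P2), and the free sets can only become equal when 𝒜 takes
-- a_t while ℋ takes h_t, which is (P3).  Finally t* < k, since 𝒜 matches every
-- request with a free server and so has none left at time k.
module Submission where

open import Defs
open import Data.Nat using (ℕ; suc; _≤_; _<_; _∸_)
open import Data.Fin using (Fin)
open import Data.Fin.Subset using (_∈_; _─_; ⁅_⁆)
open import Data.Maybe using (just)
open import Data.Vec using (Vec)
open import Data.Product using (_×_)
open import Data.Sum using (_⊎_)
open import Relation.Binary.PropositionalEquality using (_≡_; _≢_)

open import Data.Nat using (zero; _+_; z≤n; s≤s) renaming (_≟_ to _≟ℕ_)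
open import Data.Nat.Properties
  using (≤-reflexive; ≤-refl; ≤-trans; ≤-<-trans; <⇒≤; <⇒≱; ≮⇒≥; _≤?_; n≤1+n; 1+n≰n;
         +-suc; +-identityʳ; +-monoˡ-≤; +-cancelʳ-≤; module ≤-Reasoning)
open import Data.Fin using (_≟_)
open import Data.Fin.Subset using (Subset; _∉_; _-_; ∣_∣; inside; outside)
open import Data.Fin.Subset.Properties
  using (_∈?_; p─q⊆p; x∈p∧x≢y⇒x∈p-y; x∉⁅y⁆⇒x≢y; x∈⁅x⁆; x∈⁅y⁆⇒x≡y; x∈p∧x∉q⇒x∈p─q;
         x∈p⇒∣p-x∣<∣p∣; ∣⊤∣≡n)
open import Data.Fin.Permutation using (Permutation′; _⟨$⟩ʳ_; _⟨$⟩ˡ_; inverseʳ)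
open import Data.List using (List; []; _∷_; head; filter; map; allFin)
open import Data.List.Relation.Unary.Any as Any using ()
open import Data.List.Membership.Propositional using () renaming (_∈_ to _∈ₗ_)
open import Data.List.Membership.Propositional.Properties using (∈-map⁺; ∈-allFin)
open import Data.Maybe using (Maybe; nothing)
open import Data.Vec using (_∷_; here; there)
open import Data.Product using (∃; _,_; proj₁; proj₂; swap)
open import Data.Sum using (inj₁; inj₂; [_,_]′)
open import Function using (_∘_)
open import Relation.Nullary using (¬_; yes; no; contradiction)
open import Relation.Binary.PropositionalEquality using (refl; sym; trans; subst; subst₂)

private variable
  k : ℕ
  F G : Subset k
  c d x y x′ y′ z : Fin k
  m n : Maybe (Fin k)

x∈p─q⇒x∉q : ∀ {p q : Subset k} → x ∈ p ─ q → x ∉ q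
x∈p─q⇒x∉q {p = inside ∷ _} {outside ∷ _} here ()
x∈p─q⇒x∉q {p = _ ∷ _}      {_ ∷ _}       (there x∈) (there x∈q) = x∈p─q⇒x∉q x∈ x∈q

x∈p-y⇒x∈p : x ∈ F - y → x ∈ F
x∈p-y⇒x∈p {F = F} {y} = p─q⊆p F ⁅ y ⁆

x∈p-y⇒x≢y : x ∈ F - y → x ≢ y
x∈p-y⇒x≢y x∈ = x∉⁅y⁆⇒x≢y (x∈p─q⇒x∉q x∈)

x∉p-x : x ∉ F - x
x∉p-x {x = x} x∈ = x∈p─q⇒x∉q x∈ (x∈⁅x⁆ x)

x∈p∧x∉p-y⇒x≡y : x ∈ F → x ∉ F - y → x ≡ y
x∈p∧x∉p-y⇒x≡y {x = x} {y = y} x∈ x∉ with x ≟ y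
... | yes x≡y = x≡y
... | no  x≢y = contradiction (x∈p∧x≢y⇒x∈p-y x∈ x≢y) x∉

remove-⊆ : ∀ m → z ∈ remove m F → z ∈ F
remove-⊆ (just _) = x∈p-y⇒x∈p
remove-⊆ nothing  z∈ = z∈

remove-card-< : m ≡ just c → c ∈ F → ∣ remove m F ∣ < ∣ F ∣
remove-card-< refl = x∈p⇒∣p-x∣<∣p∣

-- The pointwise form of  F ─ G ≡ ⁅ x ⁆.
record Excess (F G : Subset k) (x : Fin k) : Set where
  field
    x∈F    : x ∈ F
    x∉G    : x ∉ G
    unique : z ∈ F → z ∉ G → z ≡ x

open Excess

excess : F ─ G ≡ ⁅ x ⁆ → Excess F G x
excess {F = F} {G} {x} F─G≡x = record
  { x∈F    = p─q⊆p F G x∈F─G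
  ; x∉G    = x∈p─q⇒x∉q x∈F─G
  ; unique = λ z∈F z∉G → x∈⁅y⁆⇒x≡y _ (subst (_ ∈_) F─G≡x (x∈p∧x∉q⇒x∈p─q z∈F z∉G))
  }
  where
  x∈F─G : x ∈ F ─ G
  x∈F─G = subst (x ∈_) (sym F─G≡x) (x∈⁅x⁆ x)

excess-∈ : Excess F G x → z ∈ F → z ≢ x → z ∈ G
excess-∈ {G = G} {z = z} e z∈F z≢x with z ∈? G
... | yes z∈G = z∈G
... | no  z∉G = contradiction (unique e z∈F z∉G) z≢x

excess-unique : Excess F G x → Excess F G y → x ≡ y
excess-unique e e′ = unique e′ (x∈F e) (x∉G e)

excess-irrefl : ¬ Excess F F x
excess-irrefl e = x∉G e (x∈F e)

excess-≢ : Excess F G x → c ∈ G → x ≢ c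
excess-≢ e c∈G refl = x∉G e c∈G

excess-remove : Excess F G x → x ≢ c → d ≡ c ⊎ d ∉ F → Excess (F - c) (G - d) x
excess-remove {F = F} {G} {x} {c} {d} e x≢c d≡c⊎d∉F = record
  { x∈F    = x∈p∧x≢y⇒x∈p-y (x∈F e) x≢c
  ; x∉G    = x∉G e ∘ x∈p-y⇒x∈p
  ; unique = λ z∈ z∉ → unique e (x∈p-y⇒x∈p z∈) (z∉G z∈ z∉)
  }
  where
  z∉G : z ∈ F - c → z ∉ G - d → z ∉ G
  z∉G z∈ z∉ z∈G with refl ← x∈p∧x∉p-y⇒x≡y z∈G z∉ =
    [ x∈p-y⇒x≢y z∈ , (λ d∉F → d∉F (x∈p-y⇒x∈p z∈)) ]′ d≡c⊎d∉F

excess-transfer : Excess F G x → c ∈ F → c ∈ G → Excess (F - x) (G - c) c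
excess-transfer e c∈F c∈G = record
  { x∈F    = x∈p∧x≢y⇒x∈p-y c∈F (excess-≢ e c∈G ∘ sym)
  ; x∉G    = x∉p-x
  ; unique = λ z∈ z∉ →
      x∈p∧x∉p-y⇒x≡y (excess-∈ e (x∈p-y⇒x∈p z∈) (x∈p-y⇒x≢y z∈)) z∉
  }

excess-swapped : Excess F G x → y ∉ F → ¬ Excess (F - x) (G - y) z
excess-swapped {F = F} {G} {z = z} e y∉F e′ =
  x∉G e′ (x∈p∧x≢y⇒x∈p-y z∈G (λ { refl → y∉F z∈F }))
  where
  z∈F : z ∈ F
  z∈F = x∈p-y⇒x∈p (x∈F e′)
  z∈G : z ∈ G
  z∈G = excess-∈ e z∈F (x∈p-y⇒x≢y (x∈F e′))

Exchange : Subset k → Subset k → Fin k → Fin k → Set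
Exchange F G x y = Excess F G x × Excess G F y

exchange-remove-common : Exchange F G x y → c ∈ F → c ∈ G →
                         Exchange (F - c) (G - c) x y
exchange-remove-common (eˣ , eʸ) c∈F c∈G =
  excess-remove eˣ (excess-≢ eˣ c∈G) (inj₁ refl) ,
  excess-remove eʸ (excess-≢ eʸ c∈F) (inj₁ refl)

exchange-remove-exclusiveˡ : Exchange F G x y → c ∈ F → c ∈ G →
                             Exchange (F - x) (G - c) c y
exchange-remove-exclusiveˡ (eˣ , eʸ) c∈F c∈G =
  excess-transfer eˣ c∈F c∈G ,
  excess-remove eʸ (excess-≢ eʸ c∈F) (inj₂ (x∉G eˣ))

exchange-remove-exclusiveʳ : Exchange F G x y → c ∈ F → c ∈ G →
                             Exchange (F - c) (G - y) x c
exchange-remove-exclusiveʳ e c∈F c∈G = swap (exchange-remove-exclusiveˡ (swap e) c∈G c∈F)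

exchange-remove-exclusive : Exchange F G x y → ¬ Exchange (F - x) (G - y) x′ y′
exchange-remove-exclusive (eˣ , eʸ) (e′ , _) = excess-swapped eˣ (x∉G eʸ) e′

exchange-unique : Exchange F G x y → Exchange F G x′ y′ → x ≡ x′ × y ≡ y′
exchange-unique (eˣ , eʸ) (e′ˣ , e′ʸ) = excess-unique eˣ e′ˣ , excess-unique eʸ e′ʸ

data Choice (F G : Subset k) (x y : Fin k) : Maybe (Fin k) → Maybe (Fin k) → Set where
  common     : c ∈ F → c ∈ G → Choice F G x y (just c) (just c)
  exclusive  : Choice F G x y (just x) (just y)
  exclusiveˡ : c ∈ F → c ∈ G → Choice F G x y (just x) (just c)
  exclusiveʳ : c ∈ F → c ∈ G → Choice F G x y (just c) (just y)

choice-swap : Choice G F y x n m → Choice F G x y m n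
choice-swap (common c∈G c∈F)     = common c∈F c∈G
choice-swap exclusive            = exclusive
choice-swap (exclusiveˡ c∈G c∈F) = exclusiveʳ c∈F c∈G
choice-swap (exclusiveʳ c∈G c∈F) = exclusiveˡ c∈F c∈G

firstIn : Subset k → List (Fin k) → Maybe (Fin k)
firstIn F = head ∘ filter (_∈? F)

∈ₗ-tail : {zs : List (Fin k)} → y ∈ F → z ∉ F → y ∈ₗ z ∷ zs → y ∈ₗ zs
∈ₗ-tail y∈F z∉F = Any.tail (λ { refl → z∉F y∈F })

choice-firstIn-after-x : Exchange F G x y → (l : List (Fin k)) → y ∈ₗ l →
                         Choice F G x y (just x) (firstIn G l)
choice-firstIn-after-x {G = G} {y = y} e (z ∷ zs) y∈l with z ∈? G
... | no z∉G = choice-firstIn-after-x e zs (∈ₗ-tail (x∈F (proj₂ e)) z∉G y∈l)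
... | yes z∈G with z ≟ y
...   | yes refl = exclusive
...   | no  z≢y  = exclusiveˡ (excess-∈ (proj₂ e) z∈G z≢y) z∈G

choice-firstIn : Exchange F G x y → (l : List (Fin k)) → x ∈ₗ l → y ∈ₗ l →
                 Choice F G x y (firstIn F l) (firstIn G l)
choice-firstIn {F = F} {G} e (z ∷ zs) x∈l y∈l with z ∈? F | z ∈? G
... | yes z∈F | yes z∈G = common z∈F z∈G
... | yes z∈F | no  z∉G with refl ← unique (proj₁ e) z∈F z∉G =
  choice-firstIn-after-x e zs (∈ₗ-tail (x∈F (proj₂ e)) z∉G y∈l)
... | no  z∉F | yes z∈G with refl ← unique (proj₂ e) z∈G z∉F =
  choice-swap (choice-firstIn-after-x (swap e) zs (∈ₗ-tail (x∈F (proj₁ e)) z∉F x∈l))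
... | no  z∉F | no  z∉G =
  choice-firstIn e zs (∈ₗ-tail (x∈F (proj₁ e)) z∉F x∈l)
                      (∈ₗ-tail (x∈F (proj₂ e)) z∉G y∈l)

firstIn-complete : (l : List (Fin k)) → y ∈ₗ l → y ∈ F →
                   ∃ λ c → firstIn F l ≡ just c × c ∈ F
firstIn-complete {F = F} (z ∷ zs) y∈l y∈F with z ∈? F
... | yes z∈F = z , refl , z∈F
... | no  z∉F = firstIn-complete zs (∈ₗ-tail y∈F z∉F y∈l) y∈F

priorities : Permutation′ k → List (Fin k)
priorities {k} π = map (π ⟨$⟩ʳ_) (allFin k)

∈-priorities : (π : Permutation′ k) (y : Fin k) → y ∈ₗ priorities π
∈-priorities π y =
  subst (_∈ₗ priorities π) (inverseʳ π) (∈-map⁺ (π ⟨$⟩ʳ_) (∈-allFin (π ⟨$⟩ˡ y)))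

pick≡firstIn : (π : Permutation′ k) (F : Subset k) → pick π F ≡ firstIn F (priorities π)
pick≡firstIn π F with filter (_∈? F) (priorities π)
... | []    = refl
... | _ ∷ _ = refl

choice-pick : (π : Permutation′ k) → Exchange F G x y → Choice F G x y (pick π F) (pick π G)
choice-pick {F = F} {G} {x} {y} π e =
  subst₂ (Choice F G x y) (sym (pick≡firstIn π F)) (sym (pick≡firstIn π G))
    (choice-firstIn e (priorities π) (∈-priorities π x) (∈-priorities π y))

Succession : (x y x′ y′ : Fin k) (m n : Maybe (Fin k)) → Set
Succession x y x′ y′ m n =
  (x ≡ x′ ⊎ y ≡ y′) ×
  ((x ≢ x′ → m ≡ just x × n ≡ just x′) × (y ≢ y′ → m ≡ just y′ × n ≡ just y))

choice-succession : Exchange F G x y → Choice F G x y m n →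
                    Exchange (remove m F) (remove n G) x′ y′ → Succession x y x′ y′ m n
choice-succession e (common c∈F c∈G) e′
  with refl , refl ← exchange-unique (exchange-remove-common e c∈F c∈G) e′ =
  inj₁ refl , (λ x≢x → contradiction refl x≢x) , (λ y≢y → contradiction refl y≢y)
choice-succession e exclusive e′ = contradiction e′ (exchange-remove-exclusive e)
choice-succession e (exclusiveˡ c∈F c∈G) e′
  with refl , refl ← exchange-unique (exchange-remove-exclusiveˡ e c∈F c∈G) e′ =
  inj₂ refl , (λ _ → refl , refl) , (λ y≢y → contradiction refl y≢y)
choice-succession e (exclusiveʳ c∈F c∈G) e′
  with refl , refl ← exchange-unique (exchange-remove-exclusiveʳ e c∈F c∈G) e′ =
  inj₁ refl , (λ x≢x → contradiction refl x≢x) , (λ _ → refl , refl)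

exchange-≢ : Exchange F G x y → F ≢ G
exchange-≢ (eˣ , _) refl = excess-irrefl eˣ

choice-closing : Exchange F G x y → Choice F G x y m n →
                 remove m F ≡ remove n G → m ≡ just x × n ≡ just y
choice-closing e (common c∈F c∈G) F′≡G′ =
  contradiction F′≡G′ (exchange-≢ (exchange-remove-common e c∈F c∈G))
choice-closing e exclusive _ = refl , refl
choice-closing e (exclusiveˡ c∈F c∈G) F′≡G′ =
  contradiction F′≡G′ (exchange-≢ (exchange-remove-exclusiveˡ e c∈F c∈G))
choice-closing e (exclusiveʳ c∈F c∈G) F′≡G′ =
  contradiction F′≡G′ (exchange-≢ (exchange-remove-exclusiveʳ e c∈F c∈G))

module _ {X : Set} where

  nth-defined : ∀ {n} (σ : Vec X n) t → t < n → ∃ λ r → nth σ t ≡ just r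
  nth-defined (r ∷ _)  zero    _         = r , refl
  nth-defined (_ ∷ σ) (suc t) (s≤s t<n) = nth-defined σ t t<n

  matched-suc : ∀ {n} (p : Policy k X) (σ : Vec X n) {t r} → nth σ t ≡ just r →
                matched p σ (suc t) ≡ p (suc t) r (free p σ t)
  matched-suc p σ {t} eq with nth σ t | eq
  ... | just _ | refl = refl

  Hybrid-after : (pri : PriorityRule k X) {i t : ℕ} (s : Fin k) (r : X) (F : Subset k) →
                 i ≤ t → Hybrid pri i s (suc t) r F ≡ pick (pri r) F
  Hybrid-after pri {i} {t} s r F i≤t with suc t ≟ℕ i
  ... | yes refl = contradiction i≤t 1+n≰n
  ... | no  _    = refl

  Greedy : Policy k X → Set
  Greedy {k} p = ∀ t r (F : Subset k) {z} → z ∈ F → ∃ λ c → p t r F ≡ just c × c ∈ F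

  MPFS-greedy : (pri : PriorityRule k X) → Greedy (MPFS pri)
  MPFS-greedy pri t r F {z} z∈F =
    subst (λ m → ∃ λ c → m ≡ just c × c ∈ F) (sym (pick≡firstIn (pri r) F))
      (firstIn-complete (priorities (pri r)) (∈-priorities (pri r) z) z∈F)

  free-suc-⊆ : ∀ {n} (p : Policy k X) (σ : Vec X n) t → z ∈ free p σ (suc t) → z ∈ free p σ t
  free-suc-⊆ p σ t = remove-⊆ (matched p σ (suc t))

  module _ {p : Policy k X} (greedy : Greedy p) (σ : Vec X k) where
    open ≤-Reasoning

    free-card : ∀ t → z ∈ free p σ t → t ≤ k → ∣ free p σ t ∣ + t ≤ k
    free-card zero _ _ = ≤-reflexive (trans (+-identityʳ _) (∣⊤∣≡n k))
    free-card (suc t) z∈ t<k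
      with r , eq ← nth-defined σ t t<k
      with c , pc , c∈F ← greedy (suc t) r (free p σ t) (free-suc-⊆ p σ t z∈) = begin
      ∣ free p σ (suc t) ∣ + suc t   ≡⟨ +-suc _ t ⟩
      suc ∣ free p σ (suc t) ∣ + t   ≤⟨ +-monoˡ-≤ t (remove-card-< m≡c c∈F) ⟩
      ∣ free p σ t ∣ + t             ≤⟨ free-card t (free-suc-⊆ p σ t z∈) (<⇒≤ t<k) ⟩
      k                              ∎
      where
      m≡c : matched p σ (suc t) ≡ just c
      m≡c = trans (matched-suc p σ eq) pc

    free-exhausted : z ∉ free p σ k
    free-exhausted z∈ = <⇒≱ (≤-<-trans z≤n (x∈p⇒∣p-x∣<∣p∣ z∈))
                            (+-cancelʳ-≤ k _ 0 (free-card k z∈ ≤-refl))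

proposition1 : {X : Set} (k : ℕ) (pri : PriorityRule k X) (σ : Vec X k)
  (i : ℕ) (s : Fin k) (tstar : ℕ) (a h : ℕ → Fin k) →
  1 ≤ i → i ≤ k →
  s ∈ free (MPFS pri) σ (i ∸ 1) →
  just s ≢ matched (MPFS pri) σ i →
  i ≤ tstar →
  (∀ t → i ≤ t → t ≤ tstar → free (MPFS pri) σ t ≢ free (Hybrid pri i s) σ t) →
  (∀ t → suc tstar ≤ t → t ≤ k → free (MPFS pri) σ t ≡ free (Hybrid pri i s) σ t) →
  (∀ t → i ≤ t → t ≤ tstar →
    (free (MPFS pri) σ t ─ free (Hybrid pri i s) σ t) ≡ ⁅ a t ⁆) →
  (∀ t → i ≤ t → t ≤ tstar →
    (free (Hybrid pri i s) σ t ─ free (MPFS pri) σ t) ≡ ⁅ h t ⁆) →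
  -- (P1)
  (∀ t → i ≤ t → t < tstar → a t ≡ a (suc t) ⊎ h t ≡ h (suc t))
  -- (P2)
  × (∀ t → i ≤ t → t < tstar →
      (a t ≢ a (suc t) →
        matched (MPFS pri) σ (suc t) ≡ just (a t)
        × matched (Hybrid pri i s) σ (suc t) ≡ just (a (suc t)))
      × (h t ≢ h (suc t) →
        matched (MPFS pri) σ (suc t) ≡ just (h (suc t))
        × matched (Hybrid pri i s) σ (suc t) ≡ just (h t)))
  -- (P3)
  × (matched (MPFS pri) σ (suc tstar) ≡ just (a tstar)
     × matched (Hybrid pri i s) σ (suc tstar) ≡ just (h tstar))
proposition1 {X} k pri σ i s tstar a h _ i≤k _ _ i≤t* _ closed diffᴬ diffᴴ =
  (λ t i≤t t<t* → proj₁ (succession t i≤t t<t*)) ,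
  (λ t i≤t t<t* → proj₂ (succession t i≤t t<t*)) ,
  choice-closing (exchangeAt tstar i≤t* ≤-refl) (choiceAt tstar i≤t* ≤-refl)
                 (closed (suc tstar) ≤-refl t*<k)
  where
  𝒜 ℋ : Policy k X
  𝒜 = MPFS pri
  ℋ = Hybrid pri i s

  exchangeAt : ∀ t → i ≤ t → t ≤ tstar → Exchange (free 𝒜 σ t) (free ℋ σ t) (a t) (h t)
  exchangeAt t i≤t t≤t* = excess (diffᴬ t i≤t t≤t*) , excess (diffᴴ t i≤t t≤t*)

  t*<k : tstar < k
  t*<k with suc tstar ≤? k
  ... | yes t*<k = t*<k
  ... | no  t*≮k = contradiction (x∈F (proj₁ (exchangeAt k i≤k (≮⇒≥ t*≮k))))
                                 (free-exhausted (MPFS-greedy pri) σ)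

  choiceAt : ∀ t → i ≤ t → t ≤ tstar →
             Choice (free 𝒜 σ t) (free ℋ σ t) (a t) (h t)
                    (matched 𝒜 σ (suc t)) (matched ℋ σ (suc t))
  choiceAt t i≤t t≤t* with r , eq ← nth-defined σ t (≤-<-trans t≤t* t*<k) =
    subst₂ (Choice _ _ _ _)
      (sym (matched-suc 𝒜 σ eq))
      (sym (trans (matched-suc ℋ σ eq) (Hybrid-after pri s r (free ℋ σ t) i≤t)))
      (choice-pick (pri r) (exchangeAt t i≤t t≤t*))

  succession : ∀ t → i ≤ t → t < tstar →
               Succession (a t) (h t) (a (suc t)) (h (suc t))
                          (matched 𝒜 σ (suc t)) (matched ℋ σ (suc t))
  succession t i≤t t<t* =
    choice-succession (exchangeAt t i≤t (<⇒≤ t<t*)) (choiceAt t i≤t (<⇒≤ t<t*))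
                      (exchangeAt (suc t) (≤-trans i≤t (n≤1+n t)) t<t*)
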